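{- Let $G$ be a strongly connected directed graph that is not a cycle, and let $W$ be a walk in $G$ of length at least $1$ with core $C(W)$. Then $C(W)$ is safe if and only if $W$ is safe, and $C(W)$ is multi-safe if and only if $W$ is multi-safe.
   Context: "$G$ is a cycle" means $G$ consists of a single directed cycle through all its nodes. A walk is a sequence of nodes with consecutive pairs being arcs; closed if first and last node coincide; a proper closed walk is a closed walk of positive length. Subwalks are contiguous subsequences (for closed walks they may wrap around the end). A walk is safe if it is a subwalk of every closed walk of $G$ containing all nodes. A walk is multi-safe if for every set of proper closed walks of $G$ such that every node lies on at least one of them, the walk is a subwalk of some walk in the set. A split is a node with at least two outgoing arcs; a join is a node with at least two incoming arcs. For $W=(w_1,\dots,w_\ell)$, $\ell\ge2$, inner nodes are $w_2,\dots,w_{\ell-1}$; let $w_i$ be the first inner join (or $w_\ell$ if none) and $w_j$ the last inner split (or $w_1$ if none). $W$ is interleaved if $i\le j+1$, non-interleaved otherwise. The core $C(W)$ is $(w_{i-1},\dots,w_{j+1})$ if $W$ is interleaved and $(w_j,\dots,w_i)$ if $W$ is non-interleaved. -}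

module Defs where

open import Data.Nat using (ℕ; zero; suc; _+_; _∸_; _≤_; _<_)
open import Data.Nat.DivMod using (_%_)
open import Data.Fin using (Fin)
open import Data.Bool using (Bool; T)
open import Data.List using (List; []; _∷_; length; take; drop)
open import Data.List.Membership.Propositional using (_∈_)
open import Data.List.Relation.Unary.All using (All)
open import Data.List.Relation.Unary.Any using (Any)
open import Data.Maybe using (Maybe; just; nothing)
open import Data.Product using (Σ; ∃; _×_)
open import Data.Sum using (_⊎_)
open import Relation.Nullary using (¬_)
open import Relation.Binary.PropositionalEquality using (_≡_; _≢_)

-- A (simple) directed graph on the node set Fin n; self-loops allowed.
record Digraph (n : ℕ) : Set where
  field
    adj : Fin n → Fin n → Bool

module _ {n : ℕ} (G : Digraph n) where
  open Digraph G

  Arc : Fin n → Fin n → Set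
  Arc u v = T (adj u v)

  data IsWalk : List (Fin n) → Set where
    single : ∀ v → IsWalk (v ∷ [])
    cons   : ∀ u v ws → Arc u v → IsWalk (v ∷ ws) → IsWalk (u ∷ v ∷ ws)

at : ∀ {A : Set} → List A → ℕ → Maybe A
at []       _       = nothing
at (x ∷ xs) zero    = just x
at (x ∷ xs) (suc i) = at xs i

-- length of a walk = number of arcs
len : ∀ {A : Set} → List A → ℕ
len xs = length xs ∸ 1

-- position i (any natural number) on a closed walk (c_0,...,c_m), c_0 = c_m,
-- read cyclically: c_(i mod m).  For m = 0 only position 0 exists.
cycAt : ∀ {A : Set} → List A → ℕ → Maybe A
cycAt []           _       = nothing
cycAt (c ∷ [])     zero    = just c
cycAt (c ∷ [])     (suc _) = nothing
cycAt (c ∷ d ∷ cs) i       = at (c ∷ d ∷ cs) (i % suc (length cs))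

-- W is a subwalk of the closed walk C (contiguous, possibly wrapping around)
SubwalkOfClosed : ∀ {A : Set} → List A → List A → Set
SubwalkOfClosed W C = ∃ λ k → ∀ t → t < length W → at W t ≡ cycAt C (k + t)

module _ {n : ℕ} (G : Digraph n) where

  IsClosedWalk : List (Fin n) → Set
  IsClosedWalk C = IsWalk G C × at C 0 ≡ at C (length C ∸ 1)

  IsProperClosedWalk : List (Fin n) → Set
  IsProperClosedWalk C = IsClosedWalk C × 1 ≤ len C

  StronglyConnected : Set
  StronglyConnected = ∀ u v → ∃ λ W → IsWalk G W × at W 0 ≡ just u × at W (length W ∸ 1) ≡ just v

  -- G consists of a single directed cycle through all its nodes
  IsCycle : Set
  IsCycle = ∃ λ C → IsClosedWalk C × length C ≡ suc n × (∀ v → v ∈ C)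
            × (∀ u v → Arc G u v → ∃ λ i → at C i ≡ just u × at C (suc i) ≡ just v)

  IsSplit : Fin n → Set
  IsSplit v = ∃ λ a → ∃ λ b → a ≢ b × Arc G v a × Arc G v b

  IsJoin : Fin n → Set
  IsJoin v = ∃ λ a → ∃ λ b → a ≢ b × Arc G a v × Arc G b v

  Safe : List (Fin n) → Set
  Safe W = ∀ C → IsClosedWalk C → (∀ v → v ∈ C) → SubwalkOfClosed W C

  MultiSafe : List (Fin n) → Set
  MultiSafe W = ∀ (Cs : List (List (Fin n))) → All IsProperClosedWalk Cs
              → (∀ v → Any (v ∈_) Cs) → Any (SubwalkOfClosed W) Cs

  JoinAt SplitAt : List (Fin n) → ℕ → Set
  JoinAt  W k = ∃ λ v → at W k ≡ just v × IsJoin v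
  SplitAt W k = ∃ λ v → at W k ≡ just v × IsSplit v

  -- W = (w_0,...,w_(L-1)) (0-indexed; inner indices 1..L-2).
  -- i is the index of the first inner join, or L-1 if there is none.
  FirstInnerJoin : List (Fin n) → ℕ → Set
  FirstInnerJoin W i =
      (1 ≤ i × i ≤ length W ∸ 2 × JoinAt W i × (∀ k → 1 ≤ k → k < i → ¬ JoinAt W k))
    ⊎ (i ≡ length W ∸ 1 × (∀ k → 1 ≤ k → k ≤ length W ∸ 2 → ¬ JoinAt W k))

  -- j is the index of the last inner split, or 0 if there is none.
  LastInnerSplit : List (Fin n) → ℕ → Set
  LastInnerSplit W j =
      (1 ≤ j × j ≤ length W ∸ 2 × SplitAt W j × (∀ k → j < k → k ≤ length W ∸ 2 → ¬ SplitAt W k))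
    ⊎ (j ≡ 0 × (∀ k → 1 ≤ k → k ≤ length W ∸ 2 → ¬ SplitAt W k))

  -- the contiguous piece (w_a,...,w_b)
  slice : List (Fin n) → ℕ → ℕ → List (Fin n)
  slice W a b = take (suc b ∸ a) (drop a W)

  IsCore : List (Fin n) → List (Fin n) → Set
  IsCore W C = ∃ λ i → ∃ λ j → FirstInnerJoin W i × LastInnerSplit W j ×
      ((i ≤ suc j × C ≡ slice W (i ∸ 1) (suc j))
     ⊎ (suc j < i × C ≡ slice W j i))

{-# OPTIONS --safe #-}
-- Suppose a closed walk contains C(W).  After the core it must continue the way W does, because
-- from the end of C(W) onwards W meets no split, so each of its nodes has a unique out-neighbour;
-- before the core it must have arrived the way W does, because the inner nodes of W up to the start
-- of C(W) are not joins, so each has a unique in-neighbour.  Hence the closed walk contains W.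
-- Conversely C(W) is a subwalk of W, so every closed walk containing W contains C(W).
module Submission where

open import Defs
open import Data.Nat using (ℕ; zero; suc; _+_; _*_; _∸_; _≤_; _<_; z≤n; s≤s; s≤s⁻¹; _≤?_; NonZero)
open import Data.Nat.Properties
  using (≤-refl; <⇒≤; ≰⇒>; ≤-<-trans; <-≤-trans; m≤n⇒m≤1+n; m≤n⇒m<n∨m≡n; ∸-monoˡ-≤; +-suc; +-assoc; +-comm; m≤m*n; m∸n+n≡m; m+[n∸m]≡n; m+n≤o⇒m≤o∸n)
open import Data.Nat.DivMod using (_%_; _/_; m%n<n; m≡m%n+[m/n]*n; [m+kn]%n≡m%n; m<n⇒m%n≡m; n%n≡0)
open import Data.Nat.Tactic.RingSolver using (solve-∀)
open import Data.List using (List; []; _∷_; length; take; drop)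
open import Data.List.Relation.Unary.All using (All; _∷_)
open import Data.List.Relation.Unary.Any as Any using (Any; here; there)
open import Data.Fin using (Fin)
open import Data.Fin.Properties using (_≟_)
open import Data.Maybe using (Maybe; just)
open import Data.Product using (∃; ∃₂; _×_; _,_; proj₁)
open import Data.Sum using (inj₁; inj₂)
open import Function.Bundles using (_⇔_; mk⇔)
open import Relation.Nullary using (¬_; yes; no)
open import Relation.Nullary.Decidable using (decidable-stable)
open import Relation.Binary.PropositionalEquality using (_≡_; refl; sym; trans; cong; subst; module ≡-Reasoning)

module _ {A : Set} where

  at-drop : ∀ (xs : List A) a t → at (drop a xs) t ≡ at xs (a + t)
  at-drop xs       zero    t = refl
  at-drop []       (suc a) t = refl
  at-drop (x ∷ xs) (suc a) t = at-drop xs a t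

  at-take : ∀ (xs : List A) {m t} → t < m → at (take m xs) t ≡ at xs t
  at-take []       {suc m} {zero}  _         = refl
  at-take []       {suc m} {suc t} _         = refl
  at-take (x ∷ xs) {suc m} {zero}  _         = refl
  at-take (x ∷ xs) {suc m} {suc t} (s≤s t<m) = at-take xs t<m

  at-take-just : ∀ (xs : List A) m t {x} → at (take m xs) t ≡ just x → at xs t ≡ just x
  at-take-just []       zero    t       ()
  at-take-just (y ∷ xs) zero    t       ()
  at-take-just []       (suc m) t       ()
  at-take-just (y ∷ xs) (suc m) zero    e = e
  at-take-just (y ∷ xs) (suc m) (suc t) e = at-take-just xs m t e

  at-just⇒< : ∀ (xs : List A) t {x} → at xs t ≡ just x → t < length xs
  at-just⇒< (y ∷ xs) zero    _ = s≤s z≤n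
  at-just⇒< (y ∷ xs) (suc t) e = s≤s (at-just⇒< xs t e)

  <⇒at-just : ∀ (xs : List A) {t} → t < length xs → ∃ λ x → at xs t ≡ just x
  <⇒at-just (y ∷ xs) {zero}  _         = y , refl
  <⇒at-just (y ∷ xs) {suc t} (s≤s t<l) = <⇒at-just xs t<l

any-with-all : ∀ {A : Set} {P Q R : A → Set} {xs : List A} →
               (∀ {x} → P x → Q x → R x) → All P xs → Any Q xs → Any R xs
any-with-all f (px ∷ _)  (here qx) = here (f px qx)
any-with-all f (_  ∷ ps) (there q) = there (any-with-all f ps q)

suc[m]%n≡suc[m%n]%n : ∀ m n .{{_ : NonZero n}} → suc m % n ≡ suc (m % n) % n
suc[m]%n≡suc[m%n]%n m n =
  trans (cong (λ q → suc q % n) (m≡m%n+[m/n]*n m n)) ([m+kn]%n≡m%n (suc (m % n)) (m / n) n)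

cycAt-periodic : ∀ {A : Set} (c d : A) cs q m → cycAt (c ∷ d ∷ cs) (q + m * len (c ∷ d ∷ cs)) ≡ cycAt (c ∷ d ∷ cs) q
cycAt-periodic c d cs q m = cong (at (c ∷ d ∷ cs)) ([m+kn]%n≡m%n q m (len (c ∷ d ∷ cs)))

module _ {n : ℕ} (G : Digraph n) where

  successor-unique : ∀ {x y z} → ¬ IsSplit G x → Arc G x y → Arc G x z → y ≡ z
  successor-unique {y = y} {z} ¬split xy xz = decidable-stable (y ≟ z) λ y≢z → ¬split (y , z , y≢z , xy , xz)

  predecessor-unique : ∀ {x y z} → ¬ IsJoin G z → Arc G x z → Arc G y z → x ≡ y
  predecessor-unique {x} {y} ¬join xz yz = decidable-stable (x ≟ y) λ x≢y → ¬join (x , y , x≢y , xz , yz)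

  walk-arc : ∀ {W} → IsWalk G W → ∀ t {x y} → at W t ≡ just x → at W (suc t) ≡ just y → Arc G x y
  walk-arc (cons u v ws uv _) zero    refl refl = uv
  walk-arc (cons u v ws _  w) (suc t) e₁   e₂   = walk-arc w t e₁ e₂

  record InfiniteWalk (f : ℕ → Maybe (Fin n)) : Set where
    field
      defined : ∀ p → ∃ λ x → f p ≡ just x
      arc     : ∀ p {x y} → f p ≡ just x → f (suc p) ≡ just y → Arc G x y

  closedWalk⇒infiniteWalk : ∀ {c d cs} → IsClosedWalk G (c ∷ d ∷ cs) → InfiniteWalk (cycAt (c ∷ d ∷ cs))
  closedWalk⇒infiniteWalk {c} {d} {cs} (walk , closed) = record { defined = defined ; arc = arc }
    where
    C = c ∷ d ∷ cs
    M = len C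

    defined : ∀ p → ∃ λ x → cycAt C p ≡ just x
    defined p = <⇒at-just C (m≤n⇒m≤1+n (m%n<n p M))

    wrap : ∀ p → at C (suc (p % M)) ≡ cycAt C (suc p)
    wrap p with m≤n⇒m<n∨m≡n (m%n<n p M)
    ... | inj₁ lt = cong (at C) (sym (trans (suc[m]%n≡suc[m%n]%n p M) (m<n⇒m%n≡m lt)))
    ... | inj₂ eq = begin
      at C (suc (p % M))   ≡⟨ cong (at C) eq ⟩
      at C M               ≡⟨ sym closed ⟩
      at C 0               ≡⟨ cong (at C) (sym (n%n≡0 M)) ⟩
      at C (M % M)         ≡⟨ cong (λ q → at C (q % M)) (sym eq) ⟩
      at C (suc (p % M) % M) ≡⟨ cong (at C) (sym (suc[m]%n≡suc[m%n]%n p M)) ⟩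
      cycAt C (suc p)      ∎
      where open ≡-Reasoning

    arc : ∀ p {x y} → cycAt C p ≡ just x → cycAt C (suc p) ≡ just y → Arc G x y
    arc p e₁ e₂ = walk-arc walk (p % M) e₁ (trans (wrap p) e₂)

  AgreesAt : (ℕ → Maybe (Fin n)) → ℕ → List (Fin n) → ℕ → Set
  AgreesAt f K W t = at W t ≡ f (K + t)

  module Forcing {f} (inf : InfiniteWalk f) {W} (walk : IsWalk G W) (K : ℕ) where
    open InfiniteWalk inf
    open ≡-Reasoning

    agrees-suc : ∀ t → suc t < length W → ¬ SplitAt G W t → AgreesAt f K W t → AgreesAt f K W (suc t)
    agrees-suc t st<L ¬split agree =
      let x , wx = <⇒at-just W (<⇒≤ st<L)
          z , wz = <⇒at-just W st<L
          y , fy = defined (K + suc t)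
          xy : Arc G x y
          xy = arc (K + t) (trans (sym agree) wx) (trans (cong f (sym (+-suc K t))) fy)
      in begin
        at W (suc t) ≡⟨ wz ⟩
        just z       ≡⟨ cong just (successor-unique (λ s → ¬split (x , wx , s)) (walk-arc walk t wx wz) xy) ⟩
        just y       ≡⟨ sym fy ⟩
        f (K + suc t) ∎

    agrees-pred : ∀ t → suc t < length W → ¬ JoinAt G W (suc t) → AgreesAt f K W (suc t) → AgreesAt f K W t
    agrees-pred t st<L ¬join agree =
      let z , wz = <⇒at-just W st<L
          x , wx = <⇒at-just W (<⇒≤ st<L)
          y , fy = defined (K + t)
          yz : Arc G y z
          yz = arc (K + t) fy (trans (cong f (sym (+-suc K t))) (trans (sym agree) wz))
      in begin
        at W t  ≡⟨ wx ⟩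
        just x  ≡⟨ cong just (predecessor-unique (λ j → ¬join (z , wz , j)) (walk-arc walk t wx wz) yz) ⟩
        just y  ≡⟨ sym fy ⟩
        f (K + t) ∎

    agrees-upward : ∀ {b} → (∀ k → b ≤ k → suc k < length W → ¬ SplitAt G W k) → AgreesAt f K W b →
                    ∀ t → b ≤ t → t < length W → AgreesAt f K W t
    agrees-upward ¬split agree zero z≤n _ = agree
    agrees-upward ¬split agree (suc t) b≤st st<L with m≤n⇒m<n∨m≡n b≤st
    ... | inj₂ refl       = agree
    ... | inj₁ (s≤s b≤t) =
      agrees-suc t st<L (¬split t b≤t st<L) (agrees-upward ¬split agree t b≤t (<⇒≤ st<L))

    agrees-downward : ∀ a → a < length W → (∀ k → 1 ≤ k → k ≤ a → ¬ JoinAt G W k) → AgreesAt f K W a →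
                      ∀ t → t ≤ a → AgreesAt f K W t
    agrees-downward zero    _    _     agree zero z≤n = agree
    agrees-downward (suc a) sa<L ¬join agree t t≤sa with m≤n⇒m<n∨m≡n t≤sa
    ... | inj₂ refl       = agree
    ... | inj₁ (s≤s t≤a) =
      agrees-downward a (<⇒≤ sa<L) (λ k 1≤k k≤a → ¬join k 1≤k (m≤n⇒m≤1+n k≤a))
        (agrees-pred a sa<L (¬join (suc a) (s≤s z≤n) ≤-refl) agree) t t≤a

  subwalk⇒slice-subwalk : ∀ W {C} a b → SubwalkOfClosed W C → SubwalkOfClosed (slice G W a b) C
  subwalk⇒slice-subwalk W {C} a b (k , agree) = k + a , λ t t<l →
    let x , sx = <⇒at-just (slice G W a b) t<l
        wx : at W (a + t) ≡ just x
        wx = trans (sym (at-drop W a t)) (at-take-just (drop a W) (suc b ∸ a) t sx)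
    in begin
      at (slice G W a b) t  ≡⟨ trans sx (sym wx) ⟩
      at W (a + t)          ≡⟨ agree (a + t) (at-just⇒< W (a + t) wx) ⟩
      cycAt C (k + (a + t)) ≡⟨ cong (cycAt C) (sym (+-assoc k a t)) ⟩
      cycAt C (k + a + t)   ∎
    where open ≡-Reasoning

  record ForcingWindow (W : List (Fin n)) (a b : ℕ) : Set where
    field
      start<end      : a < b
      end<length     : b < length W
      joinFree-upto  : ∀ k → 1 ≤ k → k ≤ a → ¬ JoinAt G W k
      splitFree-from : ∀ k → b ≤ k → suc k < length W → ¬ SplitAt G W k

  module _ {W : List (Fin n)} (walk : IsWalk G W) {a b : ℕ} (window : ForcingWindow W a b) where
    open ForcingWindow window

    window-forces : ∀ {f} → InfiniteWalk f → ∀ K → (∀ t → a ≤ t → t ≤ b → AgreesAt f K W t) →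
                    ∀ t → t < length W → AgreesAt f K W t
    window-forces inf K agree t t<L with t ≤? b
    ... | no t≰b = Forcing.agrees-upward inf walk K splitFree-from
                     (agree b (<⇒≤ start<end) ≤-refl) t (<⇒≤ (≰⇒> t≰b)) t<L
    ... | yes t≤b with t ≤? a
    ...   | yes t≤a = Forcing.agrees-downward inf walk K a (<-≤-trans start<end (<⇒≤ end<length)) joinFree-upto
                        (agree a ≤-refl (<⇒≤ start<end)) t t≤a
    ...   | no t≰a = agree t (<⇒≤ (≰⇒> t≰a)) t≤b

    at-slice : ∀ s → a + s ≤ b → at (slice G W a b) s ≡ at W (a + s)
    at-slice s a+s≤b =
      trans (at-take (drop a W) (m+n≤o⇒m≤o∸n (suc s) (s≤s (subst (_≤ b) (+-comm a s) a+s≤b)))) (at-drop W a s)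

    second-node-defined : ∀ C k → (∀ t → t < length (slice G W a b) → at (slice G W a b) t ≡ cycAt C (k + t)) →
                      ∃ λ x → cycAt C (suc k) ≡ just x
    second-node-defined C k agree =
      let a+1≤b = subst (_≤ b) (+-comm 1 a) start<end
          x , wx = <⇒at-just W (≤-<-trans a+1≤b end<length)
          sx = trans (at-slice 1 a+1≤b) wx
      in x , trans (cong (cycAt C) (+-comm 1 k)) (trans (sym (agree 1 (at-just⇒< (slice G W a b) 1 sx))) sx)

    slice-subwalk⇒subwalk : ∀ {C} → IsClosedWalk G C → SubwalkOfClosed (slice G W a b) C → SubwalkOfClosed W C
    slice-subwalk⇒subwalk {[]} _ (k , agree) with second-node-defined [] k agree
    ... | _ , ()
    slice-subwalk⇒subwalk {c ∷ []} _ (k , agree) with second-node-defined (c ∷ []) k agree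
    ... | _ , ()
    slice-subwalk⇒subwalk {C@(c ∷ d ∷ cs)} closed (k , agree) =
      K , window-forces (closedWalk⇒infiniteWalk closed) K on-window
      where
      open ≡-Reasoning
      M = len C
      -- the offset k − a of W, made non-negative by adding a periods of C
      K = k + (a * M ∸ a)

      shift : ∀ s → K + (a + s) ≡ k + s + a * M
      shift s = begin
        k + (a * M ∸ a) + (a + s) ≡⟨ rearrange k (a * M ∸ a) a s ⟩
        k + s + (a * M ∸ a + a)   ≡⟨ cong (k + s +_) (m∸n+n≡m (m≤m*n a M)) ⟩
        k + s + a * M             ∎
        where
        rearrange : ∀ k D a s → k + D + (a + s) ≡ k + s + (D + a)
        rearrange = solve-∀

      on-window-from-start : ∀ s → a + s ≤ b → AgreesAt (cycAt C) K W (a + s)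
      on-window-from-start s a+s≤b =
        let x , wx = <⇒at-just W (≤-<-trans a+s≤b end<length)
        in begin
          at W (a + s)            ≡⟨ sym (at-slice s a+s≤b) ⟩
          at (slice G W a b) s    ≡⟨ agree s (at-just⇒< (slice G W a b) s (trans (at-slice s a+s≤b) wx)) ⟩
          cycAt C (k + s)         ≡⟨ sym (cycAt-periodic c d cs (k + s) a) ⟩
          cycAt C (k + s + a * M) ≡⟨ cong (cycAt C) (sym (shift s)) ⟩
          cycAt C (K + (a + s))   ∎

      on-window : ∀ t → a ≤ t → t ≤ b → AgreesAt (cycAt C) K W t
      on-window t a≤t t≤b = subst (AgreesAt (cycAt C) K W) (m+[n∸m]≡n a≤t)
        (on-window-from-start (t ∸ a) (subst (_≤ b) (sym (m+[n∸m]≡n a≤t)) t≤b))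

    slice-safe⇔safe : Safe G (slice G W a b) ⇔ Safe G W
    slice-safe⇔safe = mk⇔
      (λ safe C closed covers → slice-subwalk⇒subwalk closed (safe C closed covers))
      (λ safe C closed covers → subwalk⇒slice-subwalk W {C} a b (safe C closed covers))

    slice-multiSafe⇔multiSafe : MultiSafe G (slice G W a b) ⇔ MultiSafe G W
    slice-multiSafe⇔multiSafe = mk⇔
      (λ safe Cs proper covers →
         any-with-all (λ p → slice-subwalk⇒subwalk (proj₁ p)) proper (safe Cs proper covers))
      (λ safe Cs closed covers → Any.map (λ {C} → subwalk⇒slice-subwalk W {C} a b) (safe Cs closed covers))

  module _ {u v : Fin n} {ws : List (Fin n)} where

    firstInnerJoin<length : ∀ {i} → FirstInnerJoin G (u ∷ v ∷ ws) i → i < length (u ∷ v ∷ ws)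
    firstInnerJoin<length (inj₁ (_ , i≤ , _)) = s≤s (m≤n⇒m≤1+n i≤)
    firstInnerJoin<length (inj₂ (refl , _))   = ≤-refl

    joinFree-before-firstInnerJoin : ∀ {i} → FirstInnerJoin G (u ∷ v ∷ ws) i →
                                     ∀ k → 1 ≤ k → k < i → ¬ JoinAt G (u ∷ v ∷ ws) k
    joinFree-before-firstInnerJoin (inj₁ (_ , _ , _ , free)) = free
    joinFree-before-firstInnerJoin (inj₂ (refl , free)) k 1≤k k<i = free k 1≤k (s≤s⁻¹ k<i)

    lastInnerSplit<length : ∀ {j} → LastInnerSplit G (u ∷ v ∷ ws) j → suc j < length (u ∷ v ∷ ws)
    lastInnerSplit<length (inj₁ (_ , j≤ , _)) = s≤s (s≤s j≤)
    lastInnerSplit<length (inj₂ (refl , _))   = s≤s (s≤s z≤n)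

    splitFree-after-lastInnerSplit : ∀ {j} → LastInnerSplit G (u ∷ v ∷ ws) j →
                                     ∀ k → j < k → suc k < length (u ∷ v ∷ ws) → ¬ SplitAt G (u ∷ v ∷ ws) k
    splitFree-after-lastInnerSplit (inj₁ (_ , _ , _ , free)) k j<k sk<L = free k j<k (s≤s⁻¹ (s≤s⁻¹ sk<L))
    splitFree-after-lastInnerSplit (inj₂ (refl , free))      k j<k sk<L = free k j<k (s≤s⁻¹ (s≤s⁻¹ sk<L))

  core⇒forcingWindow : ∀ W {C} → 1 ≤ len W → IsCore G W C → ∃₂ λ a b → ForcingWindow W a b × C ≡ slice G W a b
  core⇒forcingWindow (u ∷ v ∷ ws) _ (i , j , first , last , inj₁ (i≤1+j , refl)) = i ∸ 1 , suc j , window , refl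
    where
    ≤pred⇒< : ∀ {k i} → 1 ≤ k → k ≤ i ∸ 1 → k < i
    ≤pred⇒< {i = zero}  (s≤s _) ()
    ≤pred⇒< {i = suc i} _ k≤i = s≤s k≤i

    window : ForcingWindow (u ∷ v ∷ ws) (i ∸ 1) (suc j)
    window = record
      { start<end      = s≤s (∸-monoˡ-≤ 1 i≤1+j)
      ; end<length     = lastInnerSplit<length last
      ; joinFree-upto  = λ k 1≤k k≤i∸1 → joinFree-before-firstInnerJoin first k 1≤k (≤pred⇒< 1≤k k≤i∸1)
      ; splitFree-from = splitFree-after-lastInnerSplit last
      }
  core⇒forcingWindow (u ∷ v ∷ ws) _ (i , j , first , last , inj₂ (1+j<i , refl)) = j , i , window , refl
    where
    window : ForcingWindow (u ∷ v ∷ ws) j i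
    window = record
      { start<end      = <⇒≤ 1+j<i
      ; end<length     = firstInnerJoin<length first
      ; joinFree-upto  = λ k 1≤k k≤j → joinFree-before-firstInnerJoin first k 1≤k (≤-<-trans k≤j (<⇒≤ 1+j<i))
      ; splitFree-from = λ k i≤k → splitFree-after-lastInnerSplit last k (<-≤-trans (<⇒≤ 1+j<i) i≤k)
      }

lemma17 : ∀ {n : ℕ} (G : Digraph n) → StronglyConnected G → ¬ IsCycle G
    → (W : List (Fin n)) → IsWalk G W → 1 ≤ len W
    → (C : List (Fin n)) → IsCore G W C
    → (Safe G C ⇔ Safe G W) × (MultiSafe G C ⇔ MultiSafe G W)
lemma17 G _ _ W walk 1≤len C core with core⇒forcingWindow G W 1≤len core
... | a , b , window , refl = slice-safe⇔safe G walk window , slice-multiSafe⇔multiSafe G walk window
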